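{- Let $G$ be a finite directed graph with $|V(G)|\le k$ and assume that for some word $x\in\{+,-\}^*$ we have $p(x^k)\to G$. Then $p(x^\ell)\to G$ for every $\ell\ge 0$.
   Context: A homomorphism $f:G\to H$ between directed graphs is a map $V(G)\to V(H)$ sending edges to edges; $G\to H$ means one exists. For a word $x=x_1\ldots x_k\in\{+,-\}^k$, $p(x)$ denotes the oriented path with vertices $w_0,\dots,w_k$ and $k$ edges, the $i$-th edge being $(w_{i-1},w_i)$ if $x_i=+$ and $(w_i,w_{i-1})$ if $x_i=-$. For words, $x^k$ denotes the concatenation of $k$ copies of $x$ (with $x^0$ the empty word, so $p(x^0)$ is a single vertex). -}

module Defs where

open import Data.Nat using (ℕ; zero; suc)
import Data.Nat as ℕ
open import Data.Fin using (Fin; zero; suc; inject₁)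
open import Data.List using (List; []; _∷_; _++_; length; lookup)
open import Data.Product using (Σ; _×_; _,_)
open import Relation.Binary.PropositionalEquality using (_≡_)

record Digraph : Set₁ where
  field
    V : Set
    E : V → V → Set
open Digraph public

Hom : Digraph → Digraph → Set
Hom G H = Σ (V G → V H) λ f → ∀ u v → E G u v → E H (f u) (f v)

_⟶_ : Digraph → Digraph → Set
G ⟶ H = Hom G H

finDigraph : (n : ℕ) → (Fin n → Fin n → Set) → Digraph
finDigraph n R = record { V = Fin n ; E = R }

data Sign : Set where
  + - : Sign

Word : Set
Word = List Sign

-- Edge relation of p(x): vertices w₀..w_k (as Fin (suc k));
-- i-th edge (1-indexed) is (w_{i-1}, w_i) if x_i = + and (w_i, w_{i-1}) if x_i = -.
data PathEdge (x : Word) : Fin (ℕ.suc (length x)) → Fin (ℕ.suc (length x)) → Set where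
  fwd : (i : Fin (length x)) → lookup x i ≡ + → PathEdge x (inject₁ i) (suc i)
  bwd : (i : Fin (length x)) → lookup x i ≡ - → PathEdge x (suc i) (inject₁ i)

p : Word → Digraph
p x = record { V = Fin (ℕ.suc (length x)) ; E = PathEdge x }

_^_ : Word → ℕ → Word
x ^ zero = []
x ^ ℕ.suc k = x ++ (x ^ k)

-- A homomorphism p(w) → G is the same thing as a walk in G whose steps follow
-- the signs of w.  A walk along x^k passes through k + 1 ≥ n + 1 checkpoints
-- (the ends of the copies of x), so two of them coincide by pigeonhole: G has a
-- closed walk along x^d with d ≥ 1.  Going round it forever yields a walk along
-- x^ℓ for every ℓ.
module Submission where

open import Defs
open import Data.Nat using (ℕ; zero; suc; _∸_; _≤_; _<_; s≤s)
open import Data.Nat.Properties using (m<n⇒0<n∸m)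
open import Data.Fin as Fin using (Fin; toℕ; fromℕ)
open import Data.Fin.Properties using (pigeonhole)
open import Data.List using ([]; _∷_; _++_; length)
open import Data.Product using (Σ; _×_; _,_)
open import Relation.Binary.PropositionalEquality using (_≡_; refl; sym; subst)

module _ (G : Digraph) where

  data Walk : Word → V G → V G → Set where
    [] : ∀ {a} → Walk [] a a
    +∷ : ∀ {a b c w} → E G a b → Walk w b c → Walk (+ ∷ w) a c
    -∷ : ∀ {a b c w} → E G b a → Walk w b c → Walk (- ∷ w) a c

  pathEdge-suc : ∀ {s w u v} → PathEdge w u v → PathEdge (s ∷ w) (Fin.suc u) (Fin.suc v)
  pathEdge-suc (fwd i e) = fwd (Fin.suc i) e
  pathEdge-suc (bwd i e) = bwd (Fin.suc i) e

  hom-tail : ∀ {s w} → Hom (p (s ∷ w)) G → Hom (p w) G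
  hom-tail (f , h) = (λ t → f (Fin.suc t)) , λ u v e → h _ _ (pathEdge-suc e)

  hom⇒walk : ∀ w ((f , _) : Hom (p w) G) → Walk w (f Fin.zero) (f (fromℕ (length w)))
  hom⇒walk []      _       = []
  hom⇒walk (+ ∷ w) (f , h) = +∷ (h _ _ (fwd Fin.zero refl)) (hom⇒walk w (hom-tail (f , h)))
  hom⇒walk (- ∷ w) (f , h) = -∷ (h _ _ (bwd Fin.zero refl)) (hom⇒walk w (hom-tail (f , h)))

  vertexAt : ∀ {w a c} → Walk w a c → Fin (suc (length w)) → V G
  vertexAt {a = a} []       Fin.zero    = a
  vertexAt {a = a} (+∷ _ _)  Fin.zero    = a
  vertexAt         (+∷ _ wk) (Fin.suc t) = vertexAt wk t
  vertexAt {a = a} (-∷ _ _)  Fin.zero    = a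
  vertexAt         (-∷ _ wk) (Fin.suc t) = vertexAt wk t

  vertexAt-zero : ∀ {w a c} (wk : Walk w a c) → vertexAt wk Fin.zero ≡ a
  vertexAt-zero []       = refl
  vertexAt-zero (+∷ _ _) = refl
  vertexAt-zero (-∷ _ _) = refl

  vertexAt-edge : ∀ {w a c} (wk : Walk w a c) u v → PathEdge w u v →
                  E G (vertexAt wk u) (vertexAt wk v)
  vertexAt-edge (+∷ r wk) _ _ (fwd Fin.zero _)     = subst (E G _) (sym (vertexAt-zero wk)) r
  vertexAt-edge (+∷ _ wk) _ _ (fwd (Fin.suc i) e)  = vertexAt-edge wk _ _ (fwd i e)
  vertexAt-edge (+∷ _ _)  _ _ (bwd Fin.zero ())
  vertexAt-edge (+∷ _ wk) _ _ (bwd (Fin.suc i) e)  = vertexAt-edge wk _ _ (bwd i e)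
  vertexAt-edge (-∷ _ _)  _ _ (fwd Fin.zero ())
  vertexAt-edge (-∷ _ wk) _ _ (fwd (Fin.suc i) e)  = vertexAt-edge wk _ _ (fwd i e)
  vertexAt-edge (-∷ r wk) _ _ (bwd Fin.zero _)     = subst (λ z → E G z _) (sym (vertexAt-zero wk)) r
  vertexAt-edge (-∷ _ wk) _ _ (bwd (Fin.suc i) e)  = vertexAt-edge wk _ _ (bwd i e)

  walk⇒hom : ∀ {w a c} → Walk w a c → Hom (p w) G
  walk⇒hom wk = vertexAt wk , vertexAt-edge wk

  _++ʷ_ : ∀ {u v a b c} → Walk u a b → Walk v b c → Walk (u ++ v) a c
  []        ++ʷ wk′ = wk′
  (+∷ r wk) ++ʷ wk′ = +∷ r (wk ++ʷ wk′)
  (-∷ r wk) ++ʷ wk′ = -∷ r (wk ++ʷ wk′)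

  splitWalk : ∀ u {v a c} → Walk (u ++ v) a c → Σ (V G) λ b → Walk u a b × Walk v b c
  splitWalk []      wk = _ , [] , wk
  splitWalk (+ ∷ u) (+∷ r wk) with b , wk₁ , wk₂ ← splitWalk u wk = b , +∷ r wk₁ , wk₂
  splitWalk (- ∷ u) (-∷ r wk) with b , wk₁ , wk₂ ← splitWalk u wk = b , -∷ r wk₁ , wk₂

  module _ (x : Word) where

    data Chain : ℕ → V G → V G → Set where
      [] : ∀ {a} → Chain 0 a a
      _∷_ : ∀ {k a b c} → Walk x a b → Chain k b c → Chain (suc k) a c

    walk⇒chain : ∀ k {a c} → Walk (x ^ k) a c → Chain k a c
    walk⇒chain zero    []  = []
    walk⇒chain (suc k) wk with _ , wk₁ , wk₂ ← splitWalk x wk = wk₁ ∷ walk⇒chain k wk₂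

    chain⇒walk : ∀ {k a c} → Chain k a c → Walk (x ^ k) a c
    chain⇒walk []        = []
    chain⇒walk (wk ∷ ch) = wk ++ʷ chain⇒walk ch

    checkpoint : ∀ {k a c} → Chain k a c → Fin (suc k) → V G
    checkpoint {a = a} _        Fin.zero    = a
    checkpoint         (_ ∷ ch) (Fin.suc i) = checkpoint ch i

    take : ∀ {k a c} (j : Fin (suc k)) (ch : Chain k a c) → Chain (toℕ j) a (checkpoint ch j)
    take Fin.zero    _         = []
    take (Fin.suc j) (wk ∷ ch) = wk ∷ take j ch

    segment : ∀ {k a c} (i j : Fin (suc k)) → i Fin.< j → (ch : Chain k a c) →
              Chain (toℕ j ∸ toℕ i) (checkpoint ch i) (checkpoint ch j)
    segment Fin.zero    j           _         ch       = take j ch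
    segment (Fin.suc i) (Fin.suc j) (s≤s i<j) (_ ∷ ch) = segment i j i<j ch

    -- Going round the cycle forever: ℓ decreases at every step.
    unroll : ∀ {m d a b} → Chain m a b → (cycle : Chain d b b) → 0 < d →
             ∀ ℓ → Σ (V G) (Chain ℓ a)
    unroll _         _         _   zero    = _ , []
    unroll (wk ∷ ch) cycle     d>0 (suc ℓ) with c , ch′ ← unroll ch cycle d>0 ℓ = c , wk ∷ ch′
    unroll []        (wk ∷ ch) d>0 (suc ℓ) with c , ch′ ← unroll ch (wk ∷ ch) d>0 ℓ = c , wk ∷ ch′

closedChain : ∀ {k n} {R : Fin n → Fin n → Set} {x a c} → n ≤ k →
              (ch : Chain (finDigraph n R) x k a c) →
              Σ ℕ λ d → 0 < d × Σ (Fin n) λ b → Chain (finDigraph n R) x d b b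
closedChain {R = R} {x} n≤k ch
  with i , j , i<j , same ← pigeonhole (s≤s n≤k) (checkpoint (finDigraph _ R) x ch) =
    _ , m<n⇒0<n∸m i<j , _ , subst (Chain _ x _ _) (sym same) (segment _ x i j i<j ch)

lemma8 : (k n : ℕ) (R : Fin n → Fin n → Set) → n ≤ k → (x : Word) →
         p (x ^ k) ⟶ finDigraph n R → (ℓ : ℕ) → p (x ^ ℓ) ⟶ finDigraph n R
lemma8 k n R n≤k x φ ℓ =
  let G                 = finDigraph n R
      _ , d>0 , _ , cyc = closedChain n≤k (walk⇒chain G x k (hom⇒walk G (x ^ k) φ))
      _ , ch            = unroll G x [] cyc d>0 ℓ
  in walk⇒hom G (chain⇒walk G x ch)
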